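{- Let $G$ be a connected graph of order $n$. Then $pd_s(G)=n$ if and only if $G$ is a complete graph.
   Context: Graphs are finite, simple, connected; $d_G$ is shortest-path distance, $d_G(x,W)=\min\{d_G(x,w):w\in W\}$. A set $W$ strongly resolves different vertices $x,y\notin W$ if $d_G(x,W)=d_G(x,y)+d_G(y,W)$ or $d_G(y,W)=d_G(y,x)+d_G(x,W)$. A vertex partition $\Pi$ is a strong resolving partition if every two different vertices in the same set of $\Pi$ are strongly resolved by some set of $\Pi$; the strong partition dimension $pd_s(G)$ is the minimum cardinality of such a partition. -}

module Defs where

open import Data.Nat using (ℕ; zero; suc; _+_; _≤_)
open import Data.Fin using (Fin)
open import Data.Product using (Σ; ∃; ∃-syntax; _×_; _,_)
open import Data.Sum using (_⊎_)
open import Relation.Nullary using (¬_; Dec)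
open import Relation.Binary.PropositionalEquality using (_≡_; _≢_)

record Graph (n : ℕ) : Set₁ where
  field
    Adj     : Fin n → Fin n → Set
    adj?    : ∀ x y → Dec (Adj x y)
    sym     : ∀ {x y} → Adj x y → Adj y x
    irrefl  : ∀ {x} → ¬ Adj x x
open Graph public

module _ {n : ℕ} (G : Graph n) where

  data Walk : Fin n → Fin n → ℕ → Set where
    nil  : ∀ x → Walk x x 0
    cons : ∀ {x y z k} → Adj G x y → Walk y z k → Walk x z (suc k)

  Connected : Set
  Connected = ∀ x y → ∃[ k ] Walk x y k

  Complete : Set
  Complete = ∀ x y → x ≢ y → Adj G x y

  IsDist : Fin n → Fin n → ℕ → Set
  IsDist x y d = Walk x y d × (∀ k → Walk x y k → d ≤ k)

  IsDistToSet : Fin n → (Fin n → Set) → ℕ → Set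
  IsDistToSet x W d =
    (∃[ w ] (W w × IsDist x w d)) × (∀ w e → W w → IsDist x w e → d ≤ e)

  ThroughTo : (Fin n → Set) → Fin n → Fin n → Set
  ThroughTo W x y = ∃[ a ] ∃[ b ] ∃[ c ]
    (IsDistToSet x W a × IsDist x y b × IsDistToSet y W c × a ≡ b + c)

  StronglyResolves : (Fin n → Set) → Fin n → Fin n → Set
  StronglyResolves W x y = ¬ W x × ¬ W y × (ThroughTo W x y ⊎ ThroughTo W y x)

record Partition (n k : ℕ) : Set where
  field
    cls      : Fin n → Fin k
    nonempty : ∀ i → ∃[ v ] cls v ≡ i
open Partition public

Part : ∀ {n k} → Partition n k → Fin k → Fin n → Set
Part Π i v = cls Π v ≡ i

IsStrongResolvingPartition : ∀ {n k} → Graph n → Partition n k → Set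
IsStrongResolvingPartition G Π = ∀ x y → x ≢ y → cls Π x ≡ cls Π y →
  ∃[ j ] StronglyResolves G (Part Π j) x y

IsStrongPartitionDim : ∀ {n} → Graph n → ℕ → Set
IsStrongPartitionDim {n} G k =
  (Σ (Partition n k) (IsStrongResolvingPartition G)) ×
  (∀ m (Π : Partition n m) → IsStrongResolvingPartition G Π → k ≤ m)

module Submission where

-- In a complete graph every vertex outside a
-- nonempty set W is at distance exactly 1 from W, so the identity
-- d(x,W) = d(x,y) + d(y,W) would force 1 ≥ 1 + 1 whenever x ≠ y lie
-- outside W.  Hence no set strongly resolves two vertices, every strong
-- resolving partition has only singleton classes (its class map is
-- injective), and so it has at least n classes; the partition into
-- singletons attains n.
--
-- If some x ≠ y are non-adjacent, walking from x to
-- y (connectivity) leaves the closed neighbourhood of x at some step,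
-- which exhibits an induced path a - b - c.  Merging a and b into one
-- class and keeping all other vertices as singletons gives n - 1 classes,
-- and this partition is strongly resolving: the singleton {c} satisfies
-- d(a,{c}) = 2 = d(a,b) + d(b,{c}).  This contradicts minimality of n.

open import Defs
open import Data.Nat using (ℕ; suc; _+_; _≤_; _<_; z≤n; s≤s)
open import Data.Nat.Properties using (≤-trans; ≤-refl; +-mono-≤; <⇒≱)
open import Data.Fin using (Fin; punchOut; punchIn)
open import Data.Fin.Properties
  using (_≟_; punchOut-cong; punchOut-injective; punchOut-punchIn; punchInᵢ≢i; injective⇒≤)
open import Data.Product using (_×_; _,_; proj₁; proj₂; ∃-syntax; Σ)
open import Data.Sum using (_⊎_; inj₁; inj₂)
open import Data.Empty using (⊥; ⊥-elim)
open import Function using (_∘_)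
open import Relation.Nullary using (¬_; yes; no)
open import Relation.Binary.PropositionalEquality
  using (_≡_; _≢_; refl; trans) renaming (sym to ≡-sym)

module _ {n : ℕ} (G : Graph n) where

  adjacent⇒distinct : ∀ {x y} → Adj G x y → x ≢ y
  adjacent⇒distinct e refl = irrefl G e

  walk-length≥1 : ∀ {x y k} → x ≢ y → Walk G x y k → 1 ≤ k
  walk-length≥1 x≢y (nil _)    = ⊥-elim (x≢y refl)
  walk-length≥1 _   (cons _ _) = s≤s z≤n

  walk-length≥2 : ∀ {x y k} → x ≢ y → ¬ Adj G x y → Walk G x y k → 2 ≤ k
  walk-length≥2 x≢y _   (nil _)                   = ⊥-elim (x≢y refl)
  walk-length≥2 _   ¬xy (cons xy (nil _))         = ⊥-elim (¬xy xy)
  walk-length≥2 _   _   (cons _ (cons _ _))       = s≤s (s≤s z≤n)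

  edge : ∀ {x y} → Adj G x y → Walk G x y 1
  edge {y = y} xy = cons xy (nil y)

  dist-adjacent : ∀ {x y} → Adj G x y → IsDist G x y 1
  dist-adjacent xy = edge xy , λ _ → walk-length≥1 (adjacent⇒distinct xy)

  dist-singleton : ∀ {x c d} (W : Fin n → Set) → W c → (∀ w → W w → w ≡ c) →
                   IsDist G x c d → IsDistToSet G x W d
  dist-singleton {x} {c} {d} W Wc only-c xc = (c , Wc , xc) , minimal
    where
    minimal : ∀ w e → W w → IsDist G x w e → d ≤ e
    minimal w e Ww xw with only-c w Ww
    ... | refl = proj₂ xc e (proj₁ xw)

  record InducedP3 : Set where
    field
      a b c : Fin n
      ab    : Adj G a b
      bc    : Adj G b c
      ¬ac   : ¬ Adj G a c
      a≢c   : a ≢ c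

  -- Some walk from x to a non-adjacent y ≠ x leaves the closed neighbourhood
  -- of x; the first exit step  p → q  (p ∈ N[x], q ∉ N[x]) yields x - p - q.
  nonadjacent⇒inducedP3 : ∀ {x y} → x ≢ y → ¬ Adj G x y →
                           ∀ {p k} → (p ≡ x ⊎ Adj G x p) → Walk G p y k → InducedP3
  nonadjacent⇒inducedP3 x≢y _   (inj₁ refl) (nil _) = ⊥-elim (x≢y refl)
  nonadjacent⇒inducedP3 _   ¬xy (inj₂ xy)   (nil _) = ⊥-elim (¬xy xy)
  nonadjacent⇒inducedP3 {x} x≢y ¬xy {p} p∈N[x] (cons {y = q} pq w) with q ≟ x | adj? G x q
  ... | yes q≡x | _      = nonadjacent⇒inducedP3 x≢y ¬xy (inj₁ q≡x) w
  ... | no _    | yes xq = nonadjacent⇒inducedP3 x≢y ¬xy (inj₂ xq) w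
  ... | no q≢x  | no ¬xq with p∈N[x]
  ...   | inj₁ refl = ⊥-elim (¬xq pq)
  ...   | inj₂ xp   = record { a = x ; b = p ; c = q ; ab = xp ; bc = pq
                             ; ¬ac = ¬xq ; a≢c = q≢x ∘ ≡-sym }

  -- In a complete graph no set W strongly resolves distinct x, y ∉ W:
  -- d(x,W) ≤ 1 whereas d(x,y) + d(y,W) ≥ 2.
  complete⇒¬through : Complete G → (W : Fin n → Set) → ∀ {x y} → x ≢ y →
                      ¬ W x → ¬ W y → ¬ ThroughTo G W x y
  complete⇒¬through complete W {x} {y} x≢y x∉W y∉W
    (dxW , dxy , dyW , ((w , w∈W , _) , dxW-min) , (xy , _) , ((w′ , w′∈W , yw′ , _) , _) , refl)
    = <⇒≱ (s≤s ≤-refl) (≤-trans two≤dxy+dyW dxW≤1)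
    where
    dxW≤1 : dxW ≤ 1
    dxW≤1 = dxW-min w 1 w∈W (dist-adjacent (complete x w λ { refl → x∉W w∈W }))
    two≤dxy+dyW : 2 ≤ dxy + dyW
    two≤dxy+dyW = +-mono-≤ (walk-length≥1 x≢y xy) (walk-length≥1 (λ { refl → y∉W w′∈W }) yw′)

  complete⇒order≤classes : Complete G → ∀ k (Π : Partition n k) →
                           IsStrongResolvingPartition G Π → n ≤ k
  complete⇒order≤classes complete k Π resolving = injective⇒≤ {f = cls Π} injective
    where
    injective : ∀ {x y} → cls Π x ≡ cls Π y → x ≡ y
    injective {x} {y} same with x ≟ y
    ... | yes x≡y = x≡y
    ... | no x≢y with resolving x y x≢y same
    ...   | j , x∉W , y∉W , inj₁ t = ⊥-elim (complete⇒¬through complete (Part Π j) x≢y x∉W y∉W t)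
    ...   | j , x∉W , y∉W , inj₂ t = ⊥-elim (complete⇒¬through complete (Part Π j) (x≢y ∘ ≡-sym) y∉W x∉W t)

singletons : (n : ℕ) → Partition n n
singletons n = record { cls = λ v → v ; nonempty = λ i → i , refl }

singletons-resolving : ∀ {n} (G : Graph n) → IsStrongResolvingPartition G (singletons n)
singletons-resolving G x y x≢y same = ⊥-elim (x≢y same)

-- Merging two distinct vertices a, b of Fin (suc m): b is sent to a, and the
-- remaining suc m - 1 = m representatives are renumbered by punching out b.
module Merge {m : ℕ} {a b : Fin (suc m)} (a≢b : a ≢ b) where

  rep : Fin (suc m) → Fin (suc m)
  rep v with v ≟ b
  ... | yes _ = a
  ... | no _  = v

  rep-view : ∀ v → (v ≡ b × rep v ≡ a) ⊎ (v ≢ b × rep v ≡ v)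
  rep-view v with v ≟ b
  ... | yes v≡b = inj₁ (v≡b , refl)
  ... | no v≢b  = inj₂ (v≢b , refl)

  rep≢b : ∀ v → b ≢ rep v
  rep≢b v with rep-view v
  ... | inj₁ (_ , r≡a)   = λ b≡r → a≢b (≡-sym (trans b≡r r≡a))
  ... | inj₂ (v≢b , r≡v) = λ b≡r → v≢b (≡-sym (trans b≡r r≡v))

  partition : Partition (suc m) m
  partition = record { cls = cls′ ; nonempty = λ i → punchIn b i , cls′-punchIn i }
    where
    cls′ : Fin (suc m) → Fin m
    cls′ v = punchOut (rep≢b v)
    cls′-punchIn : ∀ i → cls′ (punchIn b i) ≡ i
    cls′-punchIn i with rep-view (punchIn b i)
    ... | inj₁ (p≡b , _) = ⊥-elim (punchInᵢ≢i b i p≡b)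
    ... | inj₂ (_ , r≡p) = trans (punchOut-cong b r≡p) (punchOut-punchIn b)

  same-class⇒same-rep : ∀ x y → cls partition x ≡ cls partition y → rep x ≡ rep y
  same-class⇒same-rep x y = punchOut-injective (rep≢b x) (rep≢b y)

  same-class⇒merged : ∀ {x y} → x ≢ y → cls partition x ≡ cls partition y →
                      (x ≡ a × y ≡ b) ⊎ (x ≡ b × y ≡ a)
  same-class⇒merged {x} {y} x≢y same with rep-view x | rep-view y | same-class⇒same-rep x y same
  ... | inj₁ (refl , _)   | inj₁ (refl , _)   | _  = ⊥-elim (x≢y refl)
  ... | inj₁ (x≡b , rx)   | inj₂ (_ , ry)     | eq = inj₂ (x≡b , trans (≡-sym ry) (trans (≡-sym eq) rx))
  ... | inj₂ (_ , rx)     | inj₁ (y≡b , ry)   | eq = inj₁ (trans (≡-sym rx) (trans eq ry) , y≡b)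
  ... | inj₂ (_ , rx)     | inj₂ (_ , ry)     | eq = ⊥-elim (x≢y (trans (≡-sym rx) (trans eq ry)))

  singleton-class : ∀ {c} → c ≢ a → c ≢ b → ∀ w → Part partition (cls partition c) w → w ≡ c
  singleton-class {c} c≢a c≢b w same with rep-view w | rep-view c | same-class⇒same-rep w c same
  ... | _               | inj₁ (c≡b , _) | _  = ⊥-elim (c≢b c≡b)
  ... | inj₁ (_ , rw)   | inj₂ (_ , rc)  | eq = ⊥-elim (c≢a (trans (≡-sym rc) (trans (≡-sym eq) rw)))
  ... | inj₂ (_ , rw)   | inj₂ (_ , rc)  | eq = trans (≡-sym rw) (trans eq rc)

-- A graph containing an induced P3 has a strong resolving partition with
-- fewer classes than vertices: merge a and b; the singleton {c} resolves them.
inducedP3⇒small-partition : ∀ {n} (G : Graph n) → InducedP3 G →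
                            ∃[ k ] (k < n × Σ (Partition n k) (IsStrongResolvingPartition G))
inducedP3⇒small-partition {suc m} G P = m , ≤-refl , partition , resolving
  where
  open InducedP3 P
  b≢a : b ≢ a
  b≢a = adjacent⇒distinct G ab ∘ ≡-sym
  b≢c : b ≢ c
  b≢c = adjacent⇒distinct G bc
  open Merge (b≢a ∘ ≡-sym)

  W : Fin (suc m) → Set
  W = Part partition (cls partition c)

  c-alone : ∀ w → W w → w ≡ c
  c-alone = singleton-class (a≢c ∘ ≡-sym) (b≢c ∘ ≡-sym)

  a∉W : ¬ W a
  a∉W a∈W = a≢c (c-alone a a∈W)
  b∉W : ¬ W b
  b∉W b∈W = b≢c (c-alone b b∈W)

  -- d(a,{c}) = 2 = d(a,b) + d(b,{c}).
  a-through-b : ThroughTo G W a b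
  a-through-b = 2 , 1 , 1
    , dist-singleton G W refl c-alone (cons ab (edge G bc) , λ _ → walk-length≥2 G a≢c ¬ac)
    , dist-adjacent G ab
    , dist-singleton G W refl c-alone (dist-adjacent G bc)
    , refl

  resolving : IsStrongResolvingPartition G partition
  resolving x y x≢y same with same-class⇒merged x≢y same
  ... | inj₁ (refl , refl) = cls partition c , a∉W , b∉W , inj₁ a-through-b
  ... | inj₂ (refl , refl) = cls partition c , b∉W , a∉W , inj₂ a-through-b

theorem16 : (n : ℕ) (G : Graph n) → Connected G →
    (IsStrongPartitionDim G n → Complete G) × (Complete G → IsStrongPartitionDim G n)
theorem16 n G connected = dim⇒complete , complete⇒dim
  where
  dim⇒complete : IsStrongPartitionDim G n → Complete G
  dim⇒complete (_ , minimal) x y x≢y with adj? G x y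
  ... | yes xy = xy
  ... | no ¬xy with inducedP3⇒small-partition G
                      (nonadjacent⇒inducedP3 G x≢y ¬xy (inj₁ refl) (proj₂ (connected x y)))
  ...   | k , k<n , Π , resolving = ⊥-elim (<⇒≱ k<n (minimal k Π resolving))

  complete⇒dim : Complete G → IsStrongPartitionDim G n
  complete⇒dim complete = (singletons n , singletons-resolving G) , complete⇒order≤classes G complete
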